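{- Let $\mathcal M$ be an $EL3^-$-model (as defined in the context). Then the set $\mathit{BEL}\subseteq M$ is a filter of the underlying Heyting algebra. If moreover $f_K(m)\le f_\neg(f_\neg(m))$ for all $m\in M$, then $\mathit{BEL}\subseteq\mathit{TRUE}$ and $\mathit{BEL}$ is a proper filter.
   Context: An $EL3^-$-model is a Heyting algebra $(M,f_\bot,f_\top,f_\vee,f_\wedge,f_\rightarrow)$ (bottom $f_\bot$, top $f_\top$, join, meet, relative pseudo-complement; lattice order $\le$; $f_\neg(m):=f_\rightarrow(m,f_\bot)$) together with a designated ultrafilter $\mathit{TRUE}\subseteq M$, a set $\mathit{BEL}\subseteq M$ and unary operations $f_\square,f_K$ on $M$ such that for all $m,m'\in M$: (i) $f_\square(f_\vee(m,m'))\le f_\vee(f_\square(m),f_\square(m'))$; (ii) $f_\square(m)\le m$; (iii) $f_\square(f_\rightarrow(m,m'))\le f_\square(f_\rightarrow(f_\square(m),f_\square(m')))$; (iv) $f_\square(m)\in\mathit{TRUE}\iff m=f_\top$; (v) $f_K(m)\in\mathit{TRUE}\iff m\in\mathit{BEL}$; (vi) $f_K(f_\rightarrow(m,m'))\le f_\rightarrow(f_K(m),f_K(m'))$; (vii) $f_\square(m)\le f_\square(f_K(m))$. A filter is a nonempty subset closed under meets and upward closed; proper if it is not all of $M$; an ultrafilter is a maximal proper filter. -}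

module Defs where

open import Level using (Level; _⊔_; suc)
open import Data.Product using (_×_; Σ; ∃)
open import Relation.Nullary using (¬_)
open import Relation.Unary using (Pred; _∈_; _∉_; _⊆_)
open import Relation.Binary.Lattice using (HeytingAlgebra)

module _ {c ℓ₁ ℓ₂ : Level} (H : HeytingAlgebra c ℓ₁ ℓ₂) where
  open HeytingAlgebra H

  ¬H : Carrier → Carrier
  ¬H m = m ⇨ ⊥

  record IsFilter {ℓ : Level} (F : Pred Carrier ℓ) : Set (c ⊔ ℓ ⊔ ℓ₂) where
    field
      nonempty  : ∃ λ m → m ∈ F
      ∧-closed  : ∀ {m m'} → m ∈ F → m' ∈ F → (m ∧ m') ∈ F
      up-closed : ∀ {m m'} → m ∈ F → m ≤ m' → m' ∈ F

  IsProper : {ℓ : Level} → Pred Carrier ℓ → Set (c ⊔ ℓ)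
  IsProper F = ∃ λ m → m ∉ F

  IsProperFilter : {ℓ : Level} → Pred Carrier ℓ → Set (c ⊔ ℓ ⊔ ℓ₂)
  IsProperFilter F = IsFilter F × IsProper F

  -- ultrafilter: a maximal proper filter (maximality w.r.t. proper filters
  -- whose membership predicates live in the same universe level)
  IsUltrafilter : {ℓ : Level} → Pred Carrier ℓ → Set (c ⊔ suc ℓ ⊔ ℓ₂)
  IsUltrafilter {ℓ} F =
    IsProperFilter F ×
    (∀ (G : Pred Carrier ℓ) → IsProperFilter G → F ⊆ G → G ⊆ F)

record EL3⁻Model {c ℓ₁ ℓ₂ : Level} (H : HeytingAlgebra c ℓ₁ ℓ₂) (ℓ : Level)
       : Set (c ⊔ ℓ₁ ⊔ ℓ₂ ⊔ suc ℓ) where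
  open HeytingAlgebra H
  field
    TRUE : Pred Carrier ℓ
    BEL  : Pred Carrier ℓ
    f□   : Carrier → Carrier
    fK   : Carrier → Carrier
    TRUE-ultra : IsUltrafilter H TRUE
    -- the paper's equality is literal equality; we work up to the setoid
    -- equality ≈ of the algebra, so we require the extra data to respect it
    f□-cong  : ∀ {m m'} → m ≈ m' → f□ m ≈ f□ m'
    fK-cong  : ∀ {m m'} → m ≈ m' → fK m ≈ fK m'
    BEL-resp : ∀ {m m'} → m ≈ m' → m ∈ BEL → m' ∈ BEL
    ax-i   : ∀ m m' → f□ (m ∨ m') ≤ (f□ m ∨ f□ m')
    ax-ii  : ∀ m → f□ m ≤ m
    ax-iii : ∀ m m' → f□ (m ⇨ m') ≤ f□ (f□ m ⇨ f□ m')
    ax-iv  : ∀ m → (f□ m ∈ TRUE → m ≈ ⊤) × (m ≈ ⊤ → f□ m ∈ TRUE)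
    ax-v   : ∀ m → (fK m ∈ TRUE → m ∈ BEL) × (m ∈ BEL → fK m ∈ TRUE)
    ax-vi  : ∀ m m' → fK (m ⇨ m') ≤ (fK m ⇨ fK m')
    ax-vii : ∀ m → f□ m ≤ f□ (fK m)

-- By (v), BEL is the preimage of the filter TRUE under fK, and (vi) turns
-- this into closure under modus ponens; together with ⊤ ∈ BEL (from (iv) and
-- (vii)) that makes BEL a filter. Under fK m ≤ ¬¬m, a believed m has ¬¬m true,
-- and ultrafilters are ¬¬-stable: otherwise {y | m ⇨ y ∈ TRUE} would be a
-- strictly larger proper filter.
module Submission where

open import Defs
open import Level using (Level)
open import Data.Product using (_×_; _,_; proj₁; proj₂)
open import Relation.Unary using (Pred; _∈_; _∉_; _⊆_)
open import Relation.Binary.Lattice using (HeytingAlgebra)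
import Relation.Binary.Lattice.Properties.HeytingAlgebra as HeytingAlgebraProperties

module FilterProperties {c ℓ₁ ℓ₂ : Level} (H : HeytingAlgebra c ℓ₁ ℓ₂) where
  open HeytingAlgebra H
  open HeytingAlgebraProperties H using (⇨-eval; y≤x⇨y; ⇨ʳ-covariant; ⇨-distribˡ-∧-≥)

  ≤⇒⊤≤⇨ : ∀ {x y} → x ≤ y → ⊤ ≤ x ⇨ y
  ≤⇒⊤≤⇨ x≤y = transpose-⇨ (trans (x∧y≤y _ _) x≤y)

  deductivelyClosed⇒filter : ∀ {ℓ} {F : Pred Carrier ℓ} →
    (∀ {x} → ⊤ ≤ x → x ∈ F) →
    (∀ {x y} → (x ⇨ y) ∈ F → x ∈ F → y ∈ F) →
    IsFilter H F
  deductivelyClosed⇒filter {F = F} theorems∈F modusPonens = record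
    { nonempty  = ⊤ , theorems∈F refl
    ; ∧-closed  = λ x∈F y∈F → modusPonens (modusPonens pairing x∈F) y∈F
    ; up-closed = λ x∈F x≤y → modusPonens (theorems∈F (≤⇒⊤≤⇨ x≤y)) x∈F
    }
    where
    pairing : ∀ {x y} → (x ⇨ y ⇨ x ∧ y) ∈ F
    pairing = theorems∈F (transpose-⇨ (transpose-⇨ (∧-greatest (trans (x∧y≤x _ _) (x∧y≤y _ _)) (x∧y≤y _ _))))

  module _ {ℓ} {F : Pred Carrier ℓ} (isFilter : IsFilter H F) where
    open IsFilter isFilter

    ⊤∈filter : ⊤ ∈ F
    ⊤∈filter = up-closed (proj₂ nonempty) (maximum _)

    filter-resp-≈ : ∀ {x y} → x ≈ y → x ∈ F → y ∈ F
    filter-resp-≈ x≈y x∈F = up-closed x∈F (reflexive x≈y)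

    filter-modusPonens : ∀ {x y} → (x ⇨ y) ∈ F → x ∈ F → y ∈ F
    filter-modusPonens x⇨y∈F x∈F = up-closed (∧-closed x⇨y∈F x∈F) ⇨-eval

    relativise : Carrier → Pred Carrier ℓ
    relativise m y = (m ⇨ y) ∈ F

    relativise-isFilter : ∀ m → IsFilter H (relativise m)
    relativise-isFilter m = record
      { nonempty  = m , up-closed ⊤∈filter (≤⇒⊤≤⇨ refl)
      ; ∧-closed  = λ m⇨x∈F m⇨y∈F → up-closed (∧-closed m⇨x∈F m⇨y∈F) (⇨-distribˡ-∧-≥ _ _ _)
      ; up-closed = λ m⇨x∈F x≤y → up-closed m⇨x∈F (⇨ʳ-covariant x≤y)
      }

  ⊥∉properFilter : ∀ {ℓ} {F : Pred Carrier ℓ} → IsProperFilter H F → ⊥ ∉ F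
  ⊥∉properFilter (isFilter , x , x∉F) ⊥∈F = x∉F (IsFilter.up-closed isFilter ⊥∈F (minimum x))

  module _ {ℓ} {F : Pred Carrier ℓ} (isUltrafilter : IsUltrafilter H F) where
    private
      isFilter = proj₁ (proj₁ isUltrafilter)
      maximal  = proj₂ isUltrafilter

    ultrafilter-¬∉⇒∈ : ∀ {m} → ¬H H m ∉ F → m ∈ F
    ultrafilter-¬∉⇒∈ {m} ¬m∉F =
      maximal (relativise isFilter m) (relativise-isFilter isFilter m , ⊥ , ¬m∉F)
              (λ x∈F → IsFilter.up-closed isFilter x∈F y≤x⇨y)
              (proj₂ (IsFilter.nonempty (relativise-isFilter isFilter m)))

    ultrafilter-¬¬-stable : ∀ {m} → ¬H H (¬H H m) ∈ F → m ∈ F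
    ultrafilter-¬¬-stable ¬¬m∈F = ultrafilter-¬∉⇒∈ λ ¬m∈F →
      ⊥∉properFilter (proj₁ isUltrafilter) (filter-modusPonens isFilter ¬¬m∈F ¬m∈F)

module EL3⁻ModelProperties {c ℓ₁ ℓ₂ ℓ : Level} {H : HeytingAlgebra c ℓ₁ ℓ₂} (𝓜 : EL3⁻Model H ℓ) where
  open HeytingAlgebra H
  open EL3⁻Model 𝓜
  open FilterProperties H

  private
    TRUE-isProperFilter = proj₁ TRUE-ultra
    TRUE-isFilter       = proj₁ TRUE-isProperFilter

  ⊤∈BEL : ⊤ ∈ BEL
  ⊤∈BEL = proj₁ (ax-v ⊤) (filter-resp-≈ TRUE-isFilter (Eq.sym fK⊤≈⊤) (⊤∈filter TRUE-isFilter))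
    where
    □K⊤∈TRUE : f□ (fK ⊤) ∈ TRUE
    □K⊤∈TRUE = IsFilter.up-closed TRUE-isFilter (proj₂ (ax-iv ⊤) Eq.refl) (ax-vii ⊤)
    fK⊤≈⊤ : fK ⊤ ≈ ⊤
    fK⊤≈⊤ = proj₁ (ax-iv (fK ⊤)) □K⊤∈TRUE

  theorems⊆BEL : ∀ {x} → ⊤ ≤ x → x ∈ BEL
  theorems⊆BEL ⊤≤x = BEL-resp (antisym ⊤≤x (maximum _)) ⊤∈BEL

  BEL-modusPonens : ∀ {x y} → (x ⇨ y) ∈ BEL → x ∈ BEL → y ∈ BEL
  BEL-modusPonens {x} {y} x⇨y∈BEL x∈BEL = proj₁ (ax-v y)
    (filter-modusPonens TRUE-isFilter
      (IsFilter.up-closed TRUE-isFilter (proj₂ (ax-v (x ⇨ y)) x⇨y∈BEL) (ax-vi x y))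
      (proj₂ (ax-v x) x∈BEL))

  BEL-isFilter : IsFilter H BEL
  BEL-isFilter = deductivelyClosed⇒filter theorems⊆BEL BEL-modusPonens

  module _ (fK≤¬¬ : ∀ m → fK m ≤ ¬H H (¬H H m)) where

    BEL⊆TRUE : BEL ⊆ TRUE
    BEL⊆TRUE {m} m∈BEL = ultrafilter-¬¬-stable TRUE-ultra
      (IsFilter.up-closed TRUE-isFilter (proj₂ (ax-v m) m∈BEL) (fK≤¬¬ m))

    BEL-isProperFilter : IsProperFilter H BEL
    BEL-isProperFilter = BEL-isFilter , ⊥ , λ ⊥∈BEL →
      ⊥∉properFilter TRUE-isProperFilter (BEL⊆TRUE ⊥∈BEL)

lemma3p12 : {c ℓ₁ ℓ₂ ℓ : Level} (H : HeytingAlgebra c ℓ₁ ℓ₂) (𝓜 : EL3⁻Model H ℓ) →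
    IsFilter H (EL3⁻Model.BEL 𝓜) ×
    ((∀ m → HeytingAlgebra._≤_ H (EL3⁻Model.fK 𝓜 m) (¬H H (¬H H m))) →
    (EL3⁻Model.BEL 𝓜 ⊆ EL3⁻Model.TRUE 𝓜) × IsProperFilter H (EL3⁻Model.BEL 𝓜))
lemma3p12 H 𝓜 = BEL-isFilter , λ fK≤¬¬ → BEL⊆TRUE fK≤¬¬ , BEL-isProperFilter fK≤¬¬
  where open EL3⁻ModelProperties 𝓜
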